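{- For every $n\ge 1$, the map $pre_2$ is injective on the set of partitions of $n$ with exactly four parts, on the set of partitions of $n$ with exactly five parts, and on the set of partitions of $n$ with exactly six parts.
   Context: A partition $\lambda=(\lambda_1,\dots,\lambda_\ell)$ of $n$ is a non-increasing sequence of positive integers summing to $n$; $\ell$ is its number of parts. $pre_2(\lambda)$ is the partition whose multiset of parts is $\{\lambda_i\lambda_j : 1\le i<j\le \ell\}$ if $\ell\ge 2$, and is the empty partition if $\ell<2$. -}

module Defs where

open import Data.Nat using (ℕ; zero; suc; _*_; _≥_; _≥?_; _>_)
open import Data.List using (List; []; _∷_; map; _++_; length)
open import Data.Nat.ListAction using (sum)
open import Data.List.Relation.Unary.All using (All)
open import Data.List.Relation.Unary.Linked using (Linked)
open import Relation.Binary.PropositionalEquality using (_≡_)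
open import Relation.Nullary using (yes; no)
open import Data.Product using (_×_)

IsPartition : List ℕ → Set
IsPartition λs = Linked _≥_ λs × All (_> 0) λs

IsPartitionOfWithParts : ℕ → ℕ → List ℕ → Set
IsPartitionOfWithParts n k λs = IsPartition λs × sum λs ≡ n × length λs ≡ k

insertDesc : ℕ → List ℕ → List ℕ
insertDesc x [] = x ∷ []
insertDesc x (y ∷ ys) with x ≥? y
... | yes _ = x ∷ y ∷ ys
... | no _  = y ∷ insertDesc x ys

sortDesc : List ℕ → List ℕ
sortDesc [] = []
sortDesc (x ∷ xs) = insertDesc x (sortDesc xs)

pairProducts : List ℕ → List ℕ
pairProducts [] = []
pairProducts (x ∷ xs) = map (x *_) xs ++ pairProducts xs

pre2 : List ℕ → List ℕ
pre2 λs = sortDesc (pairProducts λs)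

Pre2InjectiveOn : ℕ → ℕ → Set
Pre2InjectiveOn n k = (λs μs : List ℕ) →
  IsPartitionOfWithParts n k λs → IsPartitionOfWithParts n k μs →
  pre2 λs ≡ pre2 μs → λs ≡ μs

-- Write the parts as a ≥ b ≥ c ≥ … and a' ≥ b' ≥ c' ≥ … . With at least four parts the sorted pre₂
-- begins with ab, ac and ends with the two smallest products, so equal images share these four
-- products, the multiset of the remaining "middle" products (hence its sum, maximum and minimum), and
-- the product of the parts, because ∏ pre₂(λ) = (∏ λ)^(k−1).
--
-- Five parts: c = ∏ λ / (ab · de) is determined, and with it every other part.
--
-- Four and six parts: suppose a < a'. Each shared product then forces its other factor to move the
-- other way, and two numbers are fixed up to order by their sum and product. For four parts this
-- gives a'd' = bc; the total n then yields bc(a+d)² = ad(b+c)², and since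
-- bc(a+d)² − ad(b+c)² = (ab − cd)(ac − bd) this forces bc ≤ ad < a'd'. For six parts the total
-- product fixes af; the maximum and minimum of the middle give a'd' = bc and c'f' = de, after which
-- the middle sum leaves ae + bf = a'e' + b'f', hence a'e' = bf and b²·cf = a'²·cf, contradicting
-- b ≤ a < a'. By symmetry a = a', and the shared products then give the remaining parts.

{-# OPTIONS --safe #-}
module Submission where

open import Defs
open import Data.Nat
open import Data.Nat.Properties
open import Data.Nat.ListAction using (sum; product)
open import Data.Nat.ListAction.Properties using (sum-↭; product-↭; product-++)
open import Data.Nat.Tactic.RingSolver using (solve-∀)
open import Algebra.Properties.CommutativeSemigroup *-commutativeSemigroup
  using (x∙yz≈y∙xz; xy∙z≈x∙zy; xy∙z≈xz∙y) renaming (interchange to *-interchange)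
open import Data.List using (List; []; _∷_; _++_; _∷ʳ_; map; length)
open import Data.List.Properties using (∷-injective; ∷ʳ-injective; ++-assoc)
open import Data.List.Membership.Propositional using (_∈_)
open import Data.List.Relation.Unary.Any using (here; there)
open import Data.List.Relation.Unary.All as All using (All; []; _∷_)
open import Data.List.Relation.Unary.Linked using ([-]; _∷_)
open import Data.List.Relation.Binary.Permutation.Propositional
  using (_↭_; ↭-refl; ↭-sym; ↭-trans; ↭-reflexive; prep; swap)
open import Data.List.Relation.Binary.Permutation.Propositional.Properties
  using (∈-resp-↭; All-resp-↭)
open import Data.Vec using (Vec; []; _∷_; toList)
open import Data.Vec.Relation.Binary.Pointwise.Inductive using ([]; _∷_; Pointwise-≡⇒≡)
open import Data.Product using (Σ; _×_; _,_; proj₁; proj₂)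
open import Data.Sum using (_⊎_; inj₁; inj₂)
open import Relation.Binary.Core using (Rel)
open import Relation.Binary.Definitions using (Antisymmetric; tri<; tri≈; tri>)
open import Relation.Binary.PropositionalEquality
open import Relation.Nullary using (yes; no; contradiction)
open import Function using (_∘_; flip)

*-cancelʳ-≡′ : ∀ {x x' y y'} .{{_ : NonZero y}} → x * y ≡ x' * y' → y ≡ y' → x ≡ x'
*-cancelʳ-≡′ {x} {x'} {y} eq refl = *-cancelʳ-≡ x x' y eq

*-cancelˡ-≡′ : ∀ {x x' y y'} .{{_ : NonZero x}} → x * y ≡ x' * y' → x ≡ x' → y ≡ y'
*-cancelˡ-≡′ {x} {_} {y} {y'} eq refl = *-cancelˡ-≡ y y' x eq

*-≡-antitoneˡ : ∀ {x x' y y'} .{{_ : NonZero y}} → x * y ≡ x' * y' → x < x' → y' < y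
*-≡-antitoneˡ {x} {x'} {y} {y'} eq x<x' with y' <? y
... | yes y'<y = y'<y
... | no y'≮y = contradiction eq (<⇒≢ (<-≤-trans (*-monoˡ-< y x<x') (*-monoʳ-≤ x' (≮⇒≥ y'≮y))))

*-≡-antitoneʳ : ∀ {x x' y y'} .{{_ : NonZero x}} → x * y ≡ x' * y' → y < y' → x' < x
*-≡-antitoneʳ {x} {x'} {y} {y'} eq = *-≡-antitoneˡ (trans (*-comm y x) (trans eq (*-comm x' y')))

*-≡-partner : ∀ {x y x' y'} .{{_ : NonZero y}} → x * y ≡ x' * y' → x' ≡ y → x ≡ y'
*-≡-partner {x} {y} {x'} {y'} eq refl = *-cancelʳ-≡ x y' y (trans eq (*-comm x' y'))

*-≡-complementary : ∀ w x y z w' x' y' z' → w * x ≡ w' * x' → y * z ≡ y' * z' →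
  (w * z) * (x * y) ≡ (w' * z') * (x' * y')
*-≡-complementary w x y z w' x' y' z' wx≡ yz≡ = begin
  (w * z) * (x * y)     ≡⟨ *-interchange w z x y ⟩
  (w * x) * (z * y)     ≡⟨ cong₂ _*_ wx≡ (trans (*-comm z y) (trans yz≡ (*-comm y' z'))) ⟩
  (w' * x') * (z' * y') ≡⟨ *-interchange w' z' x' y' ⟨
  (w' * z') * (x' * y') ∎
  where open ≡-Reasoning

*-≡-ratio : ∀ x y z x' y' z' .{{_ : NonZero y'}} → x * y ≡ x' * y' → y * z ≡ y' * z' → x * z' ≡ x' * z
*-≡-ratio x y z x' y' z' xy≡ yz≡ = *-cancelʳ-≡ (x * z') (x' * z) y' (begin
  x * z' * y'   ≡⟨ xy∙z≈x∙zy x z' y' ⟩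
  x * (y' * z') ≡⟨ cong (x *_) yz≡ ⟨
  x * (y * z)   ≡⟨ *-assoc x y z ⟨
  x * y * z     ≡⟨ cong (_* z) xy≡ ⟩
  x' * y' * z   ≡⟨ xy∙z≈xz∙y x' y' z ⟩
  x' * z * y'   ∎)
  where open ≡-Reasoning

rearrangement-≡ : ∀ p q r s → p * r + q * s ≡ p * s + q * r → p ≡ q ⊎ r ≡ s
rearrangement-≡ zero    zero    r s eq = inj₁ refl
rearrangement-≡ zero    (suc q) r s eq = inj₂ (sym (*-cancelˡ-≡ s r (suc q) eq))
rearrangement-≡ (suc p) zero    r s eq =
  inj₂ (*-cancelˡ-≡ r s (suc p) (trans (sym (+-identityʳ _)) (trans eq (+-identityʳ _))))
rearrangement-≡ (suc p) (suc q) r s eq with rearrangement-≡ p q r s (+-cancelˡ-≡ (r + s) _ _ (begin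
  (r + s) + (p * r + q * s)  ≡⟨ unfold p q r s ⟨
  suc p * r + suc q * s      ≡⟨ eq ⟩
  suc p * s + suc q * r      ≡⟨ unfold′ p q r s ⟩
  (r + s) + (p * s + q * r)  ∎))
  where
  open ≡-Reasoning
  unfold : ∀ p q r s → suc p * r + suc q * s ≡ (r + s) + (p * r + q * s)
  unfold = solve-∀
  unfold′ : ∀ p q r s → suc p * s + suc q * r ≡ (r + s) + (p * s + q * r)
  unfold′ = solve-∀
... | inj₁ p≡q = inj₁ (cong suc p≡q)
... | inj₂ r≡s = inj₂ r≡s

sum-product-swap : ∀ {x y x' y'} → x + y ≡ x' + y' → x * y ≡ x' * y' → x ≢ x' → x' ≡ y
sum-product-swap {x} {y} {x'} {y'} sum≡ product≡ x≢x' with rearrangement-≡ x x' x y' cross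
  where
  open ≡-Reasoning
  cross : x * x + x' * y' ≡ x * y' + x' * x
  cross = begin
    x * x + x' * y'   ≡⟨ cong (x * x +_) (sym product≡) ⟩
    x * x + x * y     ≡⟨ sym (*-distribˡ-+ x x y) ⟩
    x * (x + y)       ≡⟨ cong (x *_) sum≡ ⟩
    x * (x' + y')     ≡⟨ *-distribˡ-+ x x' y' ⟩
    x * x' + x * y'   ≡⟨ +-comm (x * x') (x * y') ⟩
    x * y' + x * x'   ≡⟨ cong (x * y' +_) (*-comm x x') ⟩
    x * y' + x' * x   ∎
... | inj₁ x≡x' = contradiction x≡x' x≢x'
... | inj₂ x≡y' = sym (+-cancelˡ-≡ x y x' (trans sum≡ (trans (cong (x' +_) (sym x≡y')) (+-comm x' x))))

⊔-swap : ∀ {p q p' q'} → p ⊔ q ≡ p' ⊔ q' → p < p' → q' < q → p' ≡ q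
⊔-swap {p} {q} {p'} {q'} eq p<p' q'<q with ⊔-sel p q | ⊔-sel p' q'
... | inj₁ p⊔q≡p | _ = contradiction (subst (p' ≤_) (trans (sym eq) p⊔q≡p) (m≤m⊔n p' q')) (<⇒≱ p<p')
... | inj₂ _ | inj₂ p'⊔q'≡q' = contradiction (subst (q ≤_) (trans eq p'⊔q'≡q') (m≤n⊔m p q)) (<⇒≱ q'<q)
... | inj₂ p⊔q≡q | inj₁ p'⊔q'≡p' = trans (sym p'⊔q'≡p') (trans (sym eq) p⊔q≡q)

⊓-swap : ∀ {p q p' q'} → p ⊓ q ≡ p' ⊓ q' → p' < p → q < q' → q ≡ p'
⊓-swap {p} {q} {p'} {q'} eq p'<p q<q' with ⊓-sel p q | ⊓-sel p' q'
... | inj₁ p⊓q≡p | _ = contradiction (subst (_≤ p') (trans (sym eq) p⊓q≡p) (m⊓n≤m p' q')) (<⇒≱ p'<p)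
... | inj₂ _ | inj₂ p'⊓q'≡q' = contradiction (subst (_≤ q) (trans eq p'⊓q'≡q') (m⊓n≤n p q)) (<⇒≱ q<q')
... | inj₂ p⊓q≡q | inj₁ p'⊓q'≡p' = trans (sym p⊓q≡q) (trans eq p'⊓q'≡p')

^-cancelʳ-≡ : ∀ k .{{_ : NonZero k}} {m n} → m ^ k ≡ n ^ k → m ≡ n
^-cancelʳ-≡ k {m} {n} eq with <-cmp m n
... | tri< m<n _ _ = contradiction eq (<⇒≢ (^-monoˡ-< k m<n))
... | tri≈ _ m≡n _ = m≡n
... | tri> _ _ m>n = contradiction eq (>⇒≢ (^-monoˡ-< k m>n))

*-^-distrib : ∀ m n k → (m * n) ^ k ≡ m ^ k * n ^ k
*-^-distrib m n zero    = refl
*-^-distrib m n (suc k) = trans (cong ((m * n) *_) (*-^-distrib m n k)) (*-interchange m n (m ^ k) (n ^ k))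

↭-greatest-unique : ∀ {a ℓ} {A : Set a} {_≼_ : Rel A ℓ} → Antisymmetric _≡_ _≼_ →
  ∀ {xs ys m m'} → xs ↭ ys → m ∈ xs → All (_≼ m) xs → m' ∈ ys → All (_≼ m') ys → m ≡ m'
↭-greatest-unique antisym xs↭ys m∈xs xs≼m m'∈ys ys≼m' =
  antisym (All.lookup ys≼m' (∈-resp-↭ xs↭ys m∈xs)) (All.lookup xs≼m (∈-resp-↭ (↭-sym xs↭ys) m'∈ys))

⊔-∈ : ∀ {p q xs} → p ∈ xs → q ∈ xs → p ⊔ q ∈ xs
⊔-∈ {p} {q} p∈xs q∈xs with ⊔-sel p q
... | inj₁ p⊔q≡p = subst (_∈ _) (sym p⊔q≡p) p∈xs
... | inj₂ p⊔q≡q = subst (_∈ _) (sym p⊔q≡q) q∈xs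

⊓-∈ : ∀ {p q xs} → p ∈ xs → q ∈ xs → p ⊓ q ∈ xs
⊓-∈ {p} {q} p∈xs q∈xs with ⊓-sel p q
... | inj₁ p⊓q≡p = subst (_∈ _) (sym p⊓q≡p) p∈xs
... | inj₂ p⊓q≡q = subst (_∈ _) (sym p⊓q≡q) q∈xs

insertDesc-↭ : ∀ x xs → insertDesc x xs ↭ x ∷ xs
insertDesc-↭ x []       = ↭-refl
insertDesc-↭ x (y ∷ ys) with x ≥? y
... | yes _ = ↭-refl
... | no _  = ↭-trans (prep y (insertDesc-↭ x ys)) (swap y x ↭-refl)

sortDesc-↭ : ∀ xs → sortDesc xs ↭ xs
sortDesc-↭ []       = ↭-refl
sortDesc-↭ (x ∷ xs) = ↭-trans (insertDesc-↭ x (sortDesc xs)) (prep x (sortDesc-↭ xs))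

insertDesc-++ : ∀ x xs {ys} → All (_≤ x) ys → insertDesc x (xs ++ ys) ≡ insertDesc x xs ++ ys
insertDesc-++ x []       []          = refl
insertDesc-++ x []       {y ∷ _} (y≤x ∷ _) with x ≥? y
... | yes _  = refl
... | no y≰x = contradiction y≤x y≰x
insertDesc-++ x (y ∷ xs) ys≤x with x ≥? y
... | yes _ = refl
... | no _  = cong (y ∷_) (insertDesc-++ x xs ys≤x)

sortDesc-head : ∀ {x} xs → All (_≤ x) xs → sortDesc (x ∷ xs) ≡ x ∷ sortDesc xs
sortDesc-head xs xs≤x = insertDesc-++ _ [] (All-resp-↭ (↭-sym (sortDesc-↭ xs)) xs≤x)

sortDesc-++ : ∀ {m} xs {ys} → All (m ≤_) xs → All (_≤ m) ys → sortDesc (xs ++ ys) ≡ sortDesc xs ++ sortDesc ys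
sortDesc-++ []       _               _    = refl
sortDesc-++ (x ∷ xs) {ys} (m≤x ∷ m≤xs) ys≤m =
  trans (cong (insertDesc x) (sortDesc-++ xs m≤xs ys≤m))
        (insertDesc-++ x (sortDesc xs)
          (All-resp-↭ (↭-sym (sortDesc-↭ ys)) (All.map (λ y≤m → ≤-trans y≤m m≤x) ys≤m)))

framed : ℕ → ℕ → List ℕ → ℕ → ℕ → List ℕ
framed x y M z w = ((x ∷ y ∷ sortDesc M) ∷ʳ z) ∷ʳ w

sortDesc-framed : ∀ {x y z w} M → y ≤ x → All (_≤ y) M → All (z ≤_) M → z ≤ y → w ≤ z →
  sortDesc (x ∷ y ∷ M ++ z ∷ w ∷ []) ≡ framed x y M z w
sortDesc-framed {x} {y} {z} {w} M y≤x M≤y z≤M z≤y w≤z = begin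
  sortDesc ((x ∷ y ∷ M) ++ z ∷ w ∷ [])            ≡⟨ sortDesc-++ (x ∷ y ∷ M) (≤-trans z≤y y≤x ∷ z≤y ∷ z≤M) (≤-refl ∷ w≤z ∷ []) ⟩
  sortDesc (x ∷ y ∷ M) ++ sortDesc (z ∷ w ∷ [])   ≡⟨ cong₂ _++_ top bottom ⟩
  (x ∷ y ∷ sortDesc M) ++ z ∷ w ∷ []              ≡⟨ ++-assoc (x ∷ y ∷ sortDesc M) (z ∷ []) (w ∷ []) ⟨
  framed x y M z w                                ∎
  where
  open ≡-Reasoning
  top : sortDesc (x ∷ y ∷ M) ≡ x ∷ y ∷ sortDesc M
  top = trans (sortDesc-head (y ∷ M) (y≤x ∷ All.map (λ m≤y → ≤-trans m≤y y≤x) M≤y))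
              (cong (x ∷_) (sortDesc-head M M≤y))
  bottom : sortDesc (z ∷ w ∷ []) ≡ z ∷ w ∷ []
  bottom = sortDesc-head (w ∷ []) (w≤z ∷ [])

framed-injective : ∀ {x y z w x' y' z' w'} M M' → framed x y M z w ≡ framed x' y' M' z' w' →
  x ≡ x' × y ≡ y' × M ↭ M' × z ≡ z' × w ≡ w'
framed-injective {x} {y} {z} {w} {x'} {y'} {z'} {w'} M M' eq =
  x≡x' , y≡y' , ↭-trans (↭-sym (sortDesc-↭ M)) (↭-trans (↭-reflexive sortM≡) (sortDesc-↭ M')) , z≡z' , w≡w'
  where
  top = x ∷ y ∷ sortDesc M
  top' = x' ∷ y' ∷ sortDesc M'
  split₁ = ∷ʳ-injective (top ∷ʳ z) (top' ∷ʳ z') eq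
  w≡w' = proj₂ split₁
  split₂ = ∷ʳ-injective top top' (proj₁ split₁)
  z≡z' = proj₂ split₂
  x≡x' = proj₁ (∷-injective (proj₁ split₂))
  y≡y' = proj₁ (∷-injective (proj₂ (∷-injective (proj₁ split₂))))
  sortM≡ = proj₂ (∷-injective (proj₂ (∷-injective (proj₁ split₂))))

-- The product of pre₂

product-map-* : ∀ x xs → product (map (x *_) xs) ≡ x ^ length xs * product xs
product-map-* x []       = refl
product-map-* x (y ∷ ys) =
  trans (cong (x * y *_) (product-map-* x ys)) (*-interchange x y (x ^ length ys) (product ys))

product-pairProducts : ∀ xs → product (pairProducts xs) ≡ product xs ^ (length xs ∸ 1)
product-pairProducts []       = refl
product-pairProducts (x ∷ xs) = begin
  product (map (x *_) xs ++ pairProducts xs)            ≡⟨ product-++ (map (x *_) xs) (pairProducts xs) ⟩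
  product (map (x *_) xs) * product (pairProducts xs)   ≡⟨ cong₂ _*_ (product-map-* x xs) (product-pairProducts xs) ⟩
  x ^ n * product xs * product xs ^ (n ∸ 1)             ≡⟨ *-assoc (x ^ n) (product xs) _ ⟩
  x ^ n * (product xs * product xs ^ (n ∸ 1))           ≡⟨ cong (x ^ n *_) (absorb xs) ⟩
  x ^ n * product xs ^ n                                ≡⟨ *-^-distrib x (product xs) n ⟨
  (x * product xs) ^ n                                  ∎
  where
  open ≡-Reasoning
  n = length xs
  absorb : ∀ ys → product ys * product ys ^ (length ys ∸ 1) ≡ product ys ^ length ys
  absorb []      = refl
  absorb (_ ∷ _) = refl

product-pre2 : ∀ xs → product (pre2 xs) ≡ product xs ^ (length xs ∸ 1)
product-pre2 xs = trans (product-↭ (sortDesc-↭ (pairProducts xs))) (product-pairProducts xs)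

pre2-≡⇒product-≡ : ∀ xs ys .{{_ : NonZero (length xs ∸ 1)}} → length xs ≡ length ys →
  pre2 xs ≡ pre2 ys → product xs ≡ product ys
pre2-≡⇒product-≡ xs ys |xs|≡|ys| eq = ^-cancelʳ-≡ (length xs ∸ 1) (begin
  product xs ^ (length xs ∸ 1)   ≡⟨ product-pre2 xs ⟨
  product (pre2 xs)              ≡⟨ cong product eq ⟩
  product (pre2 ys)              ≡⟨ product-pre2 ys ⟩
  product ys ^ (length ys ∸ 1)   ≡⟨ cong (λ k → product ys ^ (k ∸ 1)) |xs|≡|ys| ⟨
  product ys ^ (length xs ∸ 1)   ∎)
  where open ≡-Reasoning

-- Indexing the parts by a Vec lets them be named by pattern matching.
Pre2InjectiveOnVec : ℕ → ℕ → Set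
Pre2InjectiveOnVec n k = ∀ {u v : Vec ℕ k} →
  IsPartitionOfWithParts n k (toList u) → IsPartitionOfWithParts n k (toList v) →
  pre2 (toList u) ≡ pre2 (toList v) → u ≡ v

asVec : ∀ {a} {A : Set a} {k} (xs : List A) → length xs ≡ k → Σ (Vec A k) λ v → xs ≡ toList v
asVec []       refl = [] , refl
asVec (x ∷ xs) refl = x ∷ proj₁ (asVec xs refl) , cong (x ∷_) (proj₂ (asVec xs refl))

Pre2InjectiveOn-fromVec : ∀ {n k} → Pre2InjectiveOnVec n k → Pre2InjectiveOn n k
Pre2InjectiveOn-fromVec inj λs μs λs-ok@(_ , _ , |λs|) μs-ok@(_ , _ , |μs|) eq
  with u , refl ← asVec λs |λs| | v , refl ← asVec μs |μs| = cong toList (inj λs-ok μs-ok eq)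

-- Four parts

middle₄ : ℕ → ℕ → ℕ → ℕ → List ℕ
middle₄ a b c d = a * d ∷ b * c ∷ []

pre2-framed₄ : ∀ {a b c d} → b ≤ a → c ≤ b → d ≤ c →
  pre2 (a ∷ b ∷ c ∷ d ∷ []) ≡ framed (a * b) (a * c) (middle₄ a b c d) (b * d) (c * d)
pre2-framed₄ {a} {b} {c} {d} b≤a c≤b d≤c = sortDesc-framed (middle₄ a b c d)
  (*-monoʳ-≤ a c≤b)
  (*-monoʳ-≤ a d≤c ∷ *-monoˡ-≤ c b≤a ∷ [])
  (*-monoˡ-≤ d b≤a ∷ *-monoʳ-≤ b d≤c ∷ [])
  (*-mono-≤ b≤a d≤c)
  (*-monoˡ-≤ d c≤b)

total-balance₄ : ∀ {a b c d a' b' c' d'} → a * b ≡ a' * b' → a * c ≡ a' * c' → a * d' ≡ a' * d →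
  sum (a ∷ b ∷ c ∷ d ∷ []) ≡ sum (a' ∷ b' ∷ c' ∷ d' ∷ []) → a ≢ a' → a' * (a + d) ≡ a * (b + c)
total-balance₄ {a} {b} {c} {d} {a'} {b'} {c'} {d'} ab≡ ac≡ ad'≡a'd total≡ a≢a'
  with rearrangement-≡ a' a (a' * (a + d)) (a * (b + c)) cross
  where
  open ≡-Reasoning
  expand : ∀ a a' b c d → a' * (a' * (a + d)) + a * (a * (b + c)) ≡ a * a' * a' + a' * (a' * d) + a * (a * b) + a * (a * c)
  expand = solve-∀
  collect : ∀ a a' b' c' d' → a * a' * a' + a' * (a * d') + a * (a' * b') + a * (a' * c') ≡ a * a' * (a' + (b' + (c' + (d' + 0))))
  collect = solve-∀
  distribute : ∀ a a' b c d → a * a' * (a + (b + (c + (d + 0)))) ≡ a' * (a * (b + c)) + a * (a' * (a + d))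
  distribute = solve-∀
  cross : a' * (a' * (a + d)) + a * (a * (b + c)) ≡ a' * (a * (b + c)) + a * (a' * (a + d))
  cross = begin
    a' * (a' * (a + d)) + a * (a * (b + c))                     ≡⟨ expand a a' b c d ⟩
    a * a' * a' + a' * (a' * d) + a * (a * b) + a * (a * c)     ≡⟨ cong (λ t → a * a' * a' + a' * t + a * (a * b) + a * (a * c)) ad'≡a'd ⟨
    a * a' * a' + a' * (a * d') + a * (a * b) + a * (a * c)     ≡⟨ cong₂ (λ s t → a * a' * a' + a' * (a * d') + a * s + a * t) ab≡ ac≡ ⟩
    a * a' * a' + a' * (a * d') + a * (a' * b') + a * (a' * c') ≡⟨ collect a a' b' c' d' ⟩
    a * a' * sum (a' ∷ b' ∷ c' ∷ d' ∷ [])                       ≡⟨ cong (a * a' *_) total≡ ⟨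
    a * a' * sum (a ∷ b ∷ c ∷ d ∷ [])                           ≡⟨ distribute a a' b c d ⟩
    a' * (a * (b + c)) + a * (a' * (a + d))                     ∎
... | inj₁ a'≡a = contradiction (sym a'≡a) a≢a'
... | inj₂ balance = balance

bc[a+d]²≡ad[b+c]²⇒bc≤ad : ∀ {a b c d} → b ≤ a → c ≤ b →
  b * c * ((a + d) * (a + d)) ≡ a * d * ((b + c) * (b + c)) → b * c ≤ a * d
bc[a+d]²≡ad[b+c]²⇒bc≤ad {a} {b} {c} {d} b≤a c≤b squares≡
  with rearrangement-≡ (a * b) (c * d) (b * d) (a * c) (+-cancelˡ-≡ (a * d * ((b + c) * (b + c))) _ _
         (trans (cong (_+ (a * b * (b * d) + c * d * (a * c))) (sym squares≡)) (identity a b c d)))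
  where
  -- bc(a+d)² − ad(b+c)² = (ab − cd)(ac − bd), with the negative terms moved across.
  identity : ∀ a b c d → b * c * ((a + d) * (a + d)) + (a * b * (b * d) + c * d * (a * c))
                       ≡ a * d * ((b + c) * (b + c)) + (a * b * (a * c) + c * d * (b * d))
  identity = solve-∀
... | inj₁ ab≡cd = begin
  b * c  ≤⟨ *-monoʳ-≤ b (≤-trans c≤b b≤a) ⟩
  b * a  ≡⟨ *-comm b a ⟩
  a * b  ≡⟨ ab≡cd ⟩
  c * d  ≤⟨ *-monoˡ-≤ d (≤-trans c≤b b≤a) ⟩
  a * d  ∎
  where open ≤-Reasoning
... | inj₂ bd≡ac = begin
  b * c  ≤⟨ *-monoˡ-≤ c b≤a ⟩
  a * c  ≡⟨ bd≡ac ⟨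
  b * d  ≤⟨ *-monoˡ-≤ d b≤a ⟩
  a * d  ∎
  where open ≤-Reasoning

largest-≮₄ : ∀ {a b c d a' b' c' d'} .{{_ : NonZero a}} .{{_ : NonZero c}} .{{_ : NonZero c'}} .{{_ : NonZero d'}} →
  b ≤ a → c ≤ b → a * b ≡ a' * b' → a * c ≡ a' * c' → c * d ≡ c' * d' → a * d + b * c ≡ a' * d' + b' * c' →
  sum (a ∷ b ∷ c ∷ d ∷ []) ≡ sum (a' ∷ b' ∷ c' ∷ d' ∷ []) → a ≮ a'
largest-≮₄ {a} {b} {c} {d} {a'} {b'} {c'} {d'} b≤a c≤b ab≡ ac≡ cd≡ middle≡ total≡ a<a' =
  <⇒≱ (*-mono-< a<a' d<d') (subst (_≤ a * d) (sym a'd'≡bc) (bc[a+d]²≡ad[b+c]²⇒bc≤ad b≤a c≤b squares≡))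
  where
  open ≡-Reasoning
  d<d' = *-≡-antitoneˡ (sym cd≡) (*-≡-antitoneˡ ac≡ a<a')
  a'd'≡bc : a' * d' ≡ b * c
  a'd'≡bc = sum-product-swap middle≡ (*-≡-complementary a b c d a' b' c' d' ab≡ cd≡) (<⇒≢ (*-mono-< a<a' d<d'))
  ad'≡a'd = *-≡-ratio a c d a' c' d' ac≡ cd≡
  a'a'd≡abc : a' * (a' * d) ≡ a * (b * c)
  a'a'd≡abc = begin
    a' * (a' * d)  ≡⟨ cong (a' *_) ad'≡a'd ⟨
    a' * (a * d')  ≡⟨ x∙yz≈y∙xz a' a d' ⟩
    a * (a' * d')  ≡⟨ cong (a *_) a'd'≡bc ⟩
    a * (b * c)    ∎
  regroup₁ : ∀ a b c d → a * (b * c * ((a + d) * (a + d))) ≡ a * (b * c) * ((a + d) * (a + d))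
  regroup₁ = solve-∀
  regroup₂ : ∀ a' d s → a' * (a' * d) * (s * s) ≡ d * (a' * s * (a' * s))
  regroup₂ = solve-∀
  regroup₃ : ∀ a d t → d * (a * t * (a * t)) ≡ a * (a * d * (t * t))
  regroup₃ = solve-∀
  squares≡ : b * c * ((a + d) * (a + d)) ≡ a * d * ((b + c) * (b + c))
  squares≡ = *-cancelˡ-≡ _ _ a (begin
    a * (b * c * ((a + d) * (a + d)))    ≡⟨ regroup₁ a b c d ⟩
    a * (b * c) * ((a + d) * (a + d))    ≡⟨ cong (_* ((a + d) * (a + d))) a'a'd≡abc ⟨
    a' * (a' * d) * ((a + d) * (a + d))  ≡⟨ regroup₂ a' d (a + d) ⟩
    d * (a' * (a + d) * (a' * (a + d)))  ≡⟨ cong (λ t → d * (t * t)) (total-balance₄ ab≡ ac≡ ad'≡a'd total≡ (<⇒≢ a<a')) ⟩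
    d * (a * (b + c) * (a * (b + c)))    ≡⟨ regroup₃ a d (b + c) ⟩
    a * (a * d * ((b + c) * (b + c)))    ∎)

pre2-injective₄ : ∀ {n} → Pre2InjectiveOnVec n 4
pre2-injective₄ {u = a ∷ b ∷ c ∷ d ∷ []} {a' ∷ b' ∷ c' ∷ d' ∷ []}
  ((b≤a ∷ c≤b ∷ d≤c ∷ [-] , a>0 ∷ _ ∷ c>0 ∷ d>0 ∷ []) , total , _)
  ((b'≤a' ∷ c'≤b' ∷ d'≤c' ∷ [-] , a'>0 ∷ _ ∷ c'>0 ∷ d'>0 ∷ []) , total' , _) eq
  with ab≡ , ac≡ , middle↭ , _ , cd≡ ← framed-injective (middle₄ a b c d) (middle₄ a' b' c' d')
         (trans (sym (pre2-framed₄ b≤a c≤b d≤c)) (trans eq (pre2-framed₄ b'≤a' c'≤b' d'≤c')))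
  = Pointwise-≡⇒≡ (a≡a' ∷ b≡b' ∷ c≡c' ∷ d≡d' ∷ [])
  where
  instance
    a≢0 = >-nonZero a>0
    c≢0 = >-nonZero c>0
    d≢0 = >-nonZero d>0
    a'≢0 = >-nonZero a'>0
    c'≢0 = >-nonZero c'>0
    d'≢0 = >-nonZero d'>0
  middle≡ : a * d + b * c ≡ a' * d' + b' * c'
  middle≡ = subst₂ (λ s t → a * d + s ≡ a' * d' + t) (+-identityʳ (b * c)) (+-identityʳ (b' * c')) (sum-↭ middle↭)
  total≡ = trans total (sym total')
  a≡a' = ≤-antisym (≮⇒≥ (largest-≮₄ b'≤a' c'≤b' (sym ab≡) (sym ac≡) (sym cd≡) (sym middle≡) (sym total≡)))
                   (≮⇒≥ (largest-≮₄ b≤a c≤b ab≡ ac≡ cd≡ middle≡ total≡))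
  b≡b' = *-cancelˡ-≡′ ab≡ a≡a'
  c≡c' = *-cancelˡ-≡′ ac≡ a≡a'
  d≡d' = *-cancelˡ-≡′ cd≡ c≡c'

-- Five parts

middle₅ : ℕ → ℕ → ℕ → ℕ → ℕ → List ℕ
middle₅ a b c d e = a * d ∷ a * e ∷ b * c ∷ b * d ∷ b * e ∷ c * d ∷ []

pre2-framed₅ : ∀ {a b c d e} → b ≤ a → c ≤ b → d ≤ c → e ≤ d →
  pre2 (a ∷ b ∷ c ∷ d ∷ e ∷ []) ≡ framed (a * b) (a * c) (middle₅ a b c d e) (c * e) (d * e)
pre2-framed₅ {a} {b} {c} {d} {e} b≤a c≤b d≤c e≤d = sortDesc-framed (middle₅ a b c d e)
  (*-monoʳ-≤ a c≤b)
  (*-monoʳ-≤ a d≤c ∷ *-monoʳ-≤ a e≤c ∷ *-monoˡ-≤ c b≤a ∷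
   *-mono-≤ b≤a d≤c ∷ *-mono-≤ b≤a e≤c ∷ *-mono-≤ c≤a d≤c ∷ [])
  (*-mono-≤ c≤a e≤d ∷ *-monoˡ-≤ e c≤a ∷ *-mono-≤ c≤b e≤c ∷
   *-mono-≤ c≤b e≤d ∷ *-monoˡ-≤ e c≤b ∷ *-monoʳ-≤ c e≤d ∷ [])
  (*-mono-≤ c≤a e≤c)
  (*-monoˡ-≤ e d≤c)
  where
  c≤a = ≤-trans c≤b b≤a
  e≤c = ≤-trans e≤d d≤c

pre2-injective₅ : ∀ {n} → Pre2InjectiveOnVec n 5
pre2-injective₅ {u = a ∷ b ∷ c ∷ d ∷ e ∷ []} {a' ∷ b' ∷ c' ∷ d' ∷ e' ∷ []}
  ((b≤a ∷ c≤b ∷ d≤c ∷ e≤d ∷ [-] , a>0 ∷ b>0 ∷ c>0 ∷ d>0 ∷ e>0 ∷ []) , _)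
  ((b'≤a' ∷ c'≤b' ∷ d'≤c' ∷ e'≤d' ∷ [-] , _) , _) eq
  with ab≡ , ac≡ , _ , ce≡ , de≡ ← framed-injective (middle₅ a b c d e) (middle₅ a' b' c' d' e')
         (trans (sym (pre2-framed₅ b≤a c≤b d≤c e≤d)) (trans eq (pre2-framed₅ b'≤a' c'≤b' d'≤c' e'≤d')))
  = Pointwise-≡⇒≡ (a≡a' ∷ b≡b' ∷ c≡c' ∷ d≡d' ∷ e≡e' ∷ [])
  where
  instance
    a≢0 = >-nonZero a>0
    b≢0 = >-nonZero b>0
    c≢0 = >-nonZero c>0
    d≢0 = >-nonZero d>0
    e≢0 = >-nonZero e>0
    abde≢0 : NonZero (a * b * (d * e))
    abde≢0 = m*n≢0 (a * b) (d * e) {{m*n≢0 a b}} {{m*n≢0 d e}}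
  open ≡-Reasoning
  regroup : ∀ a b c d e → a * (b * (c * (d * (e * 1)))) ≡ c * (a * b * (d * e))
  regroup = solve-∀
  product≡ : c * (a * b * (d * e)) ≡ c' * (a' * b' * (d' * e'))
  product≡ = begin
    c * (a * b * (d * e))                 ≡⟨ regroup a b c d e ⟨
    product (a ∷ b ∷ c ∷ d ∷ e ∷ [])      ≡⟨ pre2-≡⇒product-≡ (a ∷ b ∷ c ∷ d ∷ e ∷ []) (a' ∷ b' ∷ c' ∷ d' ∷ e' ∷ []) refl eq ⟩
    product (a' ∷ b' ∷ c' ∷ d' ∷ e' ∷ []) ≡⟨ regroup a' b' c' d' e' ⟩
    c' * (a' * b' * (d' * e'))            ∎
  c≡c' = *-cancelʳ-≡′ product≡ (cong₂ _*_ ab≡ de≡)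
  a≡a' = *-cancelʳ-≡′ ac≡ c≡c'
  b≡b' = *-cancelˡ-≡′ ab≡ a≡a'
  e≡e' = *-cancelˡ-≡′ ce≡ c≡c'
  d≡d' = *-cancelʳ-≡′ de≡ e≡e'

-- Six parts

middle₆ : ℕ → ℕ → ℕ → ℕ → ℕ → ℕ → List ℕ
middle₆ a b c d e f =
  a * d ∷ a * e ∷ a * f ∷ b * c ∷ b * d ∷ b * e ∷ b * f ∷ c * d ∷ c * e ∷ c * f ∷ d * e ∷ []

module _ {a b c d e f : ℕ} (b≤a : b ≤ a) (c≤b : c ≤ b) (d≤c : d ≤ c) (e≤d : e ≤ d) (f≤e : f ≤ e) where
  private
    c≤a = ≤-trans c≤b b≤a
    d≤b = ≤-trans d≤c c≤b
    d≤a = ≤-trans d≤b b≤a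
    e≤c = ≤-trans e≤d d≤c
    f≤d = ≤-trans f≤e e≤d
    f≤c = ≤-trans f≤d d≤c

  middle₆≤max : All (_≤ (a * d) ⊔ (b * c)) (middle₆ a b c d e f)
  middle₆≤max =
    m≤m⊔n _ _ ∷ ≤ad (*-monoʳ-≤ a e≤d) ∷ ≤ad (*-monoʳ-≤ a f≤d) ∷ m≤n⊔m _ _ ∷ ≤ad (*-monoˡ-≤ d b≤a) ∷
    ≤ad (*-mono-≤ b≤a e≤d) ∷ ≤ad (*-mono-≤ b≤a f≤d) ∷ ≤ad (*-monoˡ-≤ d c≤a) ∷ ≤ad (*-mono-≤ c≤a e≤d) ∷
    ≤ad (*-mono-≤ c≤a f≤d) ∷ ≤ad (*-mono-≤ d≤a e≤d) ∷ []
    where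
    ≤ad : ∀ {x} → x ≤ a * d → x ≤ (a * d) ⊔ (b * c)
    ≤ad x≤ad = ≤-trans x≤ad (m≤m⊔n _ _)

  min≤middle₆ : All ((c * f) ⊓ (d * e) ≤_) (middle₆ a b c d e f)
  min≤middle₆ =
    de≤ (*-mono-≤ d≤a e≤d) ∷ de≤ (*-monoˡ-≤ e d≤a) ∷ cf≤ (*-monoˡ-≤ f c≤a) ∷ de≤ (*-mono-≤ d≤b e≤c) ∷
    de≤ (*-mono-≤ d≤b e≤d) ∷ de≤ (*-monoˡ-≤ e d≤b) ∷ cf≤ (*-monoˡ-≤ f c≤b) ∷ de≤ (*-mono-≤ d≤c e≤d) ∷
    de≤ (*-monoˡ-≤ e d≤c) ∷ m⊓n≤m (c * f) (d * e) ∷ m⊓n≤n (c * f) (d * e) ∷ []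
    where
    de≤ : ∀ {x} → d * e ≤ x → (c * f) ⊓ (d * e) ≤ x
    de≤ = ≤-trans (m⊓n≤n (c * f) (d * e))
    cf≤ : ∀ {x} → c * f ≤ x → (c * f) ⊓ (d * e) ≤ x
    cf≤ = ≤-trans (m⊓n≤m (c * f) (d * e))

  pre2-framed₆ : pre2 (a ∷ b ∷ c ∷ d ∷ e ∷ f ∷ []) ≡ framed (a * b) (a * c) (middle₆ a b c d e f) (d * f) (e * f)
  pre2-framed₆ = sortDesc-framed (middle₆ a b c d e f)
    (*-monoʳ-≤ a c≤b)
    (All.map (λ x≤max → ≤-trans x≤max (⊔-lub (*-monoʳ-≤ a d≤c) (*-monoˡ-≤ c b≤a))) middle₆≤max)
    (All.map (≤-trans (⊓-glb (*-monoˡ-≤ f d≤c) (*-monoʳ-≤ d f≤e))) min≤middle₆)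
    (*-mono-≤ d≤a f≤c)
    (*-monoˡ-≤ f e≤d)

max∈middle₆ : ∀ a b c d e f → (a * d) ⊔ (b * c) ∈ middle₆ a b c d e f
max∈middle₆ a b c d e f = ⊔-∈ (here refl) (there (there (there (here refl))))

min∈middle₆ : ∀ a b c d e f → (c * f) ⊓ (d * e) ∈ middle₆ a b c d e f
min∈middle₆ a b c d e f = ⊓-∈ (there⁹ (here refl)) (there⁹ (there (here refl)))
  where
  there⁹ : ∀ {x y₁ y₂ y₃ y₄ y₅ y₆ y₇ y₈ y₉} {ys : List ℕ} →
    x ∈ ys → x ∈ y₁ ∷ y₂ ∷ y₃ ∷ y₄ ∷ y₅ ∷ y₆ ∷ y₇ ∷ y₈ ∷ y₉ ∷ ys
  there⁹ = there ∘ there ∘ there ∘ there ∘ there ∘ there ∘ there ∘ there ∘ there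

middle₆-extrema-≡ : ∀ {a b c d e f a' b' c' d' e' f'} →
  b ≤ a → c ≤ b → d ≤ c → e ≤ d → f ≤ e → b' ≤ a' → c' ≤ b' → d' ≤ c' → e' ≤ d' → f' ≤ e' →
  middle₆ a b c d e f ↭ middle₆ a' b' c' d' e' f' →
  (a * d) ⊔ (b * c) ≡ (a' * d') ⊔ (b' * c') × (c * f) ⊓ (d * e) ≡ (c' * f') ⊓ (d' * e')
middle₆-extrema-≡ {a} {b} {c} {d} {e} {f} {a'} {b'} {c'} {d'} {e'} {f'}
  b≤a c≤b d≤c e≤d f≤e b'≤a' c'≤b' d'≤c' e'≤d' f'≤e' middle↭ =
  ↭-greatest-unique ≤-antisym middle↭
    (max∈middle₆ a b c d e f) (middle₆≤max b≤a c≤b d≤c e≤d f≤e)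
    (max∈middle₆ a' b' c' d' e' f') (middle₆≤max b'≤a' c'≤b' d'≤c' e'≤d' f'≤e') ,
  ↭-greatest-unique (flip ≤-antisym) middle↭
    (min∈middle₆ a b c d e f) (min≤middle₆ b≤a c≤b d≤c e≤d f≤e)
    (min∈middle₆ a' b' c' d' e' f') (min≤middle₆ b'≤a' c'≤b' d'≤c' e'≤d' f'≤e')

first*last-≡₆ : ∀ a b c d e f a' b' c' d' e' f'
  .{{_ : NonZero a}} .{{_ : NonZero b}} .{{_ : NonZero c}} .{{_ : NonZero d}} .{{_ : NonZero e}} .{{_ : NonZero f}} →
  a * b ≡ a' * b' → a * c ≡ a' * c' → d * f ≡ d' * f' → e * f ≡ e' * f' →
  product (a ∷ b ∷ c ∷ d ∷ e ∷ f ∷ []) ≡ product (a' ∷ b' ∷ c' ∷ d' ∷ e' ∷ f' ∷ []) → a * f ≡ a' * f'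
first*last-≡₆ a b c d e f a' b' c' d' e' f' ab≡ ac≡ df≡ ef≡ product≡ =
  *-cancelʳ-≡′ (begin
    a * f * (a * f * (b * c * (d * e)))          ≡⟨ pairUp a b c d e f ⟩
    a * b * (a * c) * (d * f * (e * f))          ≡⟨ cong₂ _*_ (cong₂ _*_ ab≡ ac≡) (cong₂ _*_ df≡ ef≡) ⟩
    a' * b' * (a' * c') * (d' * f' * (e' * f'))  ≡⟨ pairUp a' b' c' d' e' f' ⟨
    a' * f' * (a' * f' * (b' * c' * (d' * e')))  ∎)
    (trans (sym (regroup a b c d e f)) (trans product≡ (regroup a' b' c' d' e' f')))
  where
  open ≡-Reasoning
  instance
    product≢0 : NonZero (a * f * (b * c * (d * e)))
    product≢0 = m*n≢0 (a * f) (b * c * (d * e)) {{m*n≢0 a f}} {{m*n≢0 (b * c) (d * e) {{m*n≢0 b c}} {{m*n≢0 d e}}}}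
  regroup : ∀ a b c d e f → a * (b * (c * (d * (e * (f * 1))))) ≡ a * f * (b * c * (d * e))
  regroup = solve-∀
  pairUp : ∀ a b c d e f → a * f * (a * f * (b * c * (d * e))) ≡ a * b * (a * c) * (d * f * (e * f))
  pairUp = solve-∀

middle₆-residue : ∀ a b c d e f a' b' c' d' e' f' →
  sum (middle₆ a b c d e f) ≡ sum (middle₆ a' b' c' d' e' f') →
  a * d ≡ b' * c' → a * f ≡ a' * f' → b * c ≡ a' * d' → b * d ≡ b' * d' → b * e ≡ b' * e' →
  c * d ≡ c' * d' → c * e ≡ c' * e' → c * f ≡ d' * e' → d * e ≡ c' * f' →
  a * e + b * f ≡ a' * e' + b' * f'
middle₆-residue a b c d e f a' b' c' d' e' f' middle≡ ad≡ af≡ bc≡ bd≡ be≡ cd≡ ce≡ cf≡ de≡ =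
  +-cancelʳ-≡ rest _ _ (begin
    (a * e + b * f) + rest      ≡⟨ split a b c d e f ⟨
    sum (middle₆ a b c d e f)   ≡⟨ middle≡ ⟩
    sum (middle₆ a' b' c' d' e' f')  ≡⟨ split′ a' b' c' d' e' f' ⟩
    (a' * e' + b' * f') + rest′ ≡⟨ cong ((a' * e' + b' * f') +_) rest≡ ⟨
    (a' * e' + b' * f') + rest  ∎)
  where
  open ≡-Reasoning
  rest = a * d + (a * f + (b * c + (b * d + (b * e + (c * d + (c * e + (c * f + d * e)))))))
  rest′ = b' * c' + (a' * f' + (a' * d' + (b' * d' + (b' * e' + (c' * d' + (c' * e' + (d' * e' + c' * f')))))))
  rest≡ : rest ≡ rest′
  rest≡ = cong₂ _+_ ad≡ (cong₂ _+_ af≡ (cong₂ _+_ bc≡ (cong₂ _+_ bd≡ (cong₂ _+_ be≡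
            (cong₂ _+_ cd≡ (cong₂ _+_ ce≡ (cong₂ _+_ cf≡ de≡)))))))
  split : ∀ a b c d e f → a * d + (a * e + (a * f + (b * c + (b * d + (b * e + (b * f + (c * d + (c * e + (c * f + (d * e + 0)))))))))) ≡
    (a * e + b * f) + (a * d + (a * f + (b * c + (b * d + (b * e + (c * d + (c * e + (c * f + d * e))))))))
  split = solve-∀
  split′ : ∀ a b c d e f → a * d + (a * e + (a * f + (b * c + (b * d + (b * e + (b * f + (c * d + (c * e + (c * f + (d * e + 0)))))))))) ≡
    (a * e + b * f) + (b * c + (a * f + (a * d + (b * d + (b * e + (c * d + (c * e + (d * e + c * f))))))))
  split′ = solve-∀

largest-≮₆ : ∀ {a b c d e f a' b' c' d' e' f'}
  .{{_ : NonZero a}} .{{_ : NonZero b}} .{{_ : NonZero c}} .{{_ : NonZero d}} .{{_ : NonZero e}} .{{_ : NonZero f}}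
  .{{_ : NonZero d'}} .{{_ : NonZero e'}} → b ≤ a →
  a * b ≡ a' * b' → a * c ≡ a' * c' → d * f ≡ d' * f' → e * f ≡ e' * f' →
  product (a ∷ b ∷ c ∷ d ∷ e ∷ f ∷ []) ≡ product (a' ∷ b' ∷ c' ∷ d' ∷ e' ∷ f' ∷ []) →
  (a * d) ⊔ (b * c) ≡ (a' * d') ⊔ (b' * c') → (c * f) ⊓ (d * e) ≡ (c' * f') ⊓ (d' * e') →
  sum (middle₆ a b c d e f) ≡ sum (middle₆ a' b' c' d' e' f') → a ≮ a'
largest-≮₆ {a} {b} {c} {d} {e} {f} {a'} {b'} {c'} {d'} {e'} {f'} b≤a ab≡ ac≡ df≡ ef≡ product≡ max≡ min≡ middle≡ a<a' =
  contradiction bb≡a'a' (<⇒≢ (*-mono-< b<a' b<a'))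
  where
  open ≡-Reasoning
  instance
    af≢0 = m*n≢0 a f
    bc≢0 = m*n≢0 b c
    cf≢0 = m*n≢0 c f
    de≢0 = m*n≢0 d e
  b<a' = ≤-<-trans b≤a a<a'
  af≡ = first*last-≡₆ a b c d e f a' b' c' d' e' f' ab≡ ac≡ df≡ ef≡ product≡
  b'<b = *-≡-antitoneˡ ab≡ a<a'
  c'<c = *-≡-antitoneˡ ac≡ a<a'
  f'<f = *-≡-antitoneˡ af≡ a<a'
  d<d' = *-≡-antitoneʳ (sym df≡) f'<f
  e<e' = *-≡-antitoneʳ (sym ef≡) f'<f
  a'd'≡bc = ⊔-swap max≡ (*-mono-< a<a' d<d') (*-mono-< b'<b c'<c)
  de≡c'f' = ⊓-swap min≡ (*-mono-< c'<c f'<f) (*-mono-< d<d' e<e')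
  via-af : ∀ x y x' y' → a * x ≡ a' * x' → y * f ≡ y' * f' → x * y ≡ x' * y'
  via-af x y x' y' ax≡ yf≡ = *-cancelˡ-≡′ (*-≡-complementary a x y f a' x' y' f' ax≡ yf≡) af≡
  cd≡ = via-af c d c' d' ac≡ df≡
  cf≡d'e' = *-≡-partner {c * f} {d * e} (*-≡-complementary c d e f c' d' e' f' cd≡ ef≡) (sym de≡c'f')
  ae+bf≡ : a * e + b * f ≡ a' * e' + b' * f'
  ae+bf≡ = middle₆-residue a b c d e f a' b' c' d' e' f' middle≡
    (*-≡-partner {a * d} {b * c} (*-≡-complementary a b c d a' b' c' d' ab≡ cd≡) a'd'≡bc) af≡ (sym a'd'≡bc)
    (via-af b d b' d' ab≡ df≡) (via-af b e b' e' ab≡ ef≡) cd≡ (via-af c e c' e' ac≡ ef≡) cf≡d'e' de≡c'f'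
  ae*bf≡ : a * e * (b * f) ≡ a' * e' * (b' * f')
  ae*bf≡ = trans (*-interchange a e b f) (trans (cong₂ _*_ ab≡ ef≡) (sym (*-interchange a' e' b' f')))
  a'e'≡bf = sum-product-swap ae+bf≡ ae*bf≡ (<⇒≢ (*-mono-< a<a' e<e'))
  bb≡a'a' : b * b ≡ a' * a'
  bb≡a'a' = *-cancelʳ-≡′ (begin
    b * b * (c * f)       ≡⟨ *-interchange b b c f ⟩
    b * c * (b * f)       ≡⟨ cong₂ _*_ a'd'≡bc a'e'≡bf ⟨
    a' * d' * (a' * e')   ≡⟨ *-interchange a' d' a' e' ⟩
    a' * a' * (d' * e')   ≡⟨ cong (a' * a' *_) cf≡d'e' ⟨
    a' * a' * (c * f)     ∎) refl

pre2-injective₆ : ∀ {n} → Pre2InjectiveOnVec n 6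
pre2-injective₆ {u = a ∷ b ∷ c ∷ d ∷ e ∷ f ∷ []} {a' ∷ b' ∷ c' ∷ d' ∷ e' ∷ f' ∷ []}
  ((b≤a ∷ c≤b ∷ d≤c ∷ e≤d ∷ f≤e ∷ [-] , a>0 ∷ b>0 ∷ c>0 ∷ d>0 ∷ e>0 ∷ f>0 ∷ []) , _)
  ((b'≤a' ∷ c'≤b' ∷ d'≤c' ∷ e'≤d' ∷ f'≤e' ∷ [-] , a'>0 ∷ b'>0 ∷ c'>0 ∷ d'>0 ∷ e'>0 ∷ f'>0 ∷ []) , _) eq
  with ab≡ , ac≡ , middle↭ , df≡ , ef≡ ← framed-injective (middle₆ a b c d e f) (middle₆ a' b' c' d' e' f')
         (trans (sym (pre2-framed₆ b≤a c≤b d≤c e≤d f≤e)) (trans eq (pre2-framed₆ b'≤a' c'≤b' d'≤c' e'≤d' f'≤e')))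
  = Pointwise-≡⇒≡ (a≡a' ∷ b≡b' ∷ c≡c' ∷ d≡d' ∷ e≡e' ∷ f≡f' ∷ [])
  where
  instance
    a≢0 = >-nonZero a>0
    b≢0 = >-nonZero b>0
    c≢0 = >-nonZero c>0
    d≢0 = >-nonZero d>0
    e≢0 = >-nonZero e>0
    f≢0 = >-nonZero f>0
    a'≢0 = >-nonZero a'>0
    b'≢0 = >-nonZero b'>0
    c'≢0 = >-nonZero c'>0
    d'≢0 = >-nonZero d'>0
    e'≢0 = >-nonZero e'>0
    f'≢0 = >-nonZero f'>0
    abc≢0 : NonZero (a * b * c)
    abc≢0 = m*n≢0 (a * b) c {{m*n≢0 a b}}
    df≢0 = m*n≢0 d f
  product≡ = pre2-≡⇒product-≡ (a ∷ b ∷ c ∷ d ∷ e ∷ f ∷ []) (a' ∷ b' ∷ c' ∷ d' ∷ e' ∷ f' ∷ []) refl eq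
  extrema = middle₆-extrema-≡ b≤a c≤b d≤c e≤d f≤e b'≤a' c'≤b' d'≤c' e'≤d' f'≤e' middle↭
  max≡ = proj₁ extrema
  min≡ = proj₂ extrema
  middle≡ = sum-↭ middle↭
  a≡a' = ≤-antisym
    (≮⇒≥ (largest-≮₆ b'≤a' (sym ab≡) (sym ac≡) (sym df≡) (sym ef≡)
                      (sym product≡) (sym max≡) (sym min≡) (sym middle≡)))
    (≮⇒≥ (largest-≮₆ b≤a ab≡ ac≡ df≡ ef≡ product≡ max≡ min≡ middle≡))
  b≡b' = *-cancelˡ-≡′ ab≡ a≡a'
  c≡c' = *-cancelˡ-≡′ ac≡ a≡a'
  regroup : ∀ a b c d e f → a * (b * (c * (d * (e * (f * 1))))) ≡ a * b * c * (e * (d * f))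
  regroup = solve-∀
  e[df]≡ : e * (d * f) ≡ e' * (d' * f')
  e[df]≡ = *-cancelˡ-≡′ (trans (sym (regroup a b c d e f)) (trans product≡ (regroup a' b' c' d' e' f')))
                        (cong₂ _*_ (cong₂ _*_ a≡a' b≡b') c≡c')
  e≡e' = *-cancelʳ-≡′ e[df]≡ df≡
  f≡f' = *-cancelˡ-≡′ ef≡ e≡e'
  d≡d' = *-cancelʳ-≡′ df≡ f≡f'

theorem1p6 : (n : ℕ) → n ≥ 1 →
    Pre2InjectiveOn n 4 × Pre2InjectiveOn n 5 × Pre2InjectiveOn n 6
theorem1p6 n _ =
  Pre2InjectiveOn-fromVec pre2-injective₄ ,
  Pre2InjectiveOn-fromVec pre2-injective₅ ,
  Pre2InjectiveOn-fromVec pre2-injective₆
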